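{- If $\mathcal{I}\subseteq\mathcal{J}$ are ideals such that every infinite set in $\mathcal{J}$ has an infinite subset in $\mathcal{I}$, then $\mathcal{I}=\mathcal{J}$.
   Context: Sets are subsets of $\omega$. A (Turing) ideal is a (countable) collection of sets closed under $\le_T$ and $\oplus$. -}

module Defs where

open import Data.Nat using (ℕ; zero; suc; _≤_; _<_)
open import Data.Fin using (Fin)
open import Data.Vec using (Vec; []; _∷_; lookup)
open import Data.Bool using (Bool; true; false)
open import Data.Product using (Σ; ∃; _×_; _,_)
open import Level using (Level; _⊔_) renaming (suc to lsuc)

SetNat : Set
SetNat = ℕ → Bool

open import Relation.Binary.PropositionalEquality using (_≡_)

-- Oracle partial recursive functions (μ-recursive functions with an oracle),
-- indexed by arity.
data PR : ℕ → Set where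
  zer  : ∀ {n} → PR n
  succ : PR 1
  proj : ∀ {n} → Fin n → PR n
  orc  : PR 1
  comp : ∀ {m n} → PR m → Vec (PR n) m → PR n
  prec : ∀ {n} → PR n → PR (suc (suc n)) → PR (suc n)
  mu   : ∀ {n} → PR (suc n) → PR n

b2n : Bool → ℕ
b2n true  = 1
b2n false = 0

mutual
  data Eval (A : SetNat) : ∀ {n} → PR n → Vec ℕ n → ℕ → Set where
    ev-zer  : ∀ {n} {xs : Vec ℕ n} → Eval A zer xs 0
    ev-succ : ∀ {x} → Eval A succ (x ∷ []) (suc x)
    ev-proj : ∀ {n} (i : Fin n) {xs : Vec ℕ n} → Eval A (proj i) xs (lookup xs i)
    ev-orc  : ∀ {x} → Eval A orc (x ∷ []) (b2n (A x))
    ev-comp : ∀ {m n} {f : PR m} {gs : Vec (PR n) m} {xs : Vec ℕ n} {ys : Vec ℕ m} {y} →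
              EvalV A xs gs ys → Eval A f ys y → Eval A (comp f gs) xs y
    ev-prec0 : ∀ {n} {g : PR n} {h : PR (suc (suc n))} {xs : Vec ℕ n} {y} →
               Eval A g xs y → Eval A (prec g h) (0 ∷ xs) y
    ev-precS : ∀ {n} {g : PR n} {h : PR (suc (suc n))} {xs : Vec ℕ n} {k r y} →
               Eval A (prec g h) (k ∷ xs) r → Eval A h (k ∷ r ∷ xs) y →
               Eval A (prec g h) (suc k ∷ xs) y
    ev-mu   : ∀ {n} {f : PR (suc n)} {xs : Vec ℕ n} {y} →
              Eval A f (y ∷ xs) 0 →
              (∀ z → z < y → Σ ℕ (λ k → Eval A f (z ∷ xs) (suc k))) →
              Eval A (mu f) xs y

  data EvalV (A : SetNat) {n : ℕ} (xs : Vec ℕ n) : ∀ {m} → Vec (PR n) m → Vec ℕ m → Set where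
    evv-[] : EvalV A xs [] []
    evv-∷  : ∀ {m} {g : PR n} {gs : Vec (PR n) m} {y} {ys : Vec ℕ m} →
             Eval A g xs y → EvalV A xs gs ys → EvalV A xs (g ∷ gs) (y ∷ ys)

_≤T_ : SetNat → SetNat → Set
Y ≤T X = Σ (PR 1) (λ e → ∀ n → Eval X e (n ∷ []) (b2n (Y n)))

-- Join: (X ⊕ Y)(2n) = X(n), (X ⊕ Y)(2n+1) = Y(n).
_⊕_ : SetNat → SetNat → SetNat
(X ⊕ Y) zero = X 0
(X ⊕ Y) (suc zero) = Y 0
(X ⊕ Y) (suc (suc n)) = ((λ k → X (suc k)) ⊕ (λ k → Y (suc k))) n

Collection : (ℓ : Level) → Set (lsuc ℓ)
Collection ℓ = SetNat → Set ℓ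

Countable : ∀ {ℓ} → Collection ℓ → Set ℓ
Countable 𝓘 = Σ (ℕ → SetNat) (λ f →
  (∀ X → 𝓘 X → Σ ℕ (λ i → ∀ n → f i n ≡ X n)) × (∀ i → 𝓘 (f i)))

record IsTuringIdeal {ℓ} (𝓘 : Collection ℓ) : Set ℓ where
  field
    countable : Countable 𝓘
    closed-≤T : ∀ X Y → 𝓘 X → Y ≤T X → 𝓘 Y
    closed-⊕  : ∀ X Y → 𝓘 X → 𝓘 Y → 𝓘 (X ⊕ Y)

_⊆ᶜ_ : ∀ {ℓ} → Collection ℓ → Collection ℓ → Set ℓ
𝓘 ⊆ᶜ 𝓙 = ∀ X → 𝓘 X → 𝓙 X

Infinite : SetNat → Set
Infinite X = ∀ n → Σ ℕ (λ m → n ≤ m × X m ≡ true)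

_⊆ˢ_ : SetNat → SetNat → Set
Y ⊆ˢ X = ∀ m → Y m ≡ true → X m ≡ true

module Submission where

-- Code the initial segment X ↾ k by the binary numeral whose digits are X 0, …, X (k - 1)
-- below a leading 1.  The set of codes of initial segments of X is computable from X and
-- infinite.  Conversely every infinite subset Y of it computes X: to decide X n, search Y
-- for an element M ≥ 2 ^ (n + 1); it codes a segment of length > n, so its n-th binary
-- digit is X n.  So each X ∈ 𝓙 is computable from the member of 𝓘 that the hypothesis
-- provides inside the codes of its initial segments.

open import Defs
open import Data.Bool using (Bool; true; false; not; T)
open import Data.Bool.Properties using (not-involutive; T-≡)
open import Data.Empty using (⊥-elim)
open import Data.Fin using (#_)
open import Data.Nat
  using (ℕ; zero; suc; _+_; _*_; _∸_; _^_; _≤_; _<_; z≤n; s≤s; pred; ⌊_/2⌋; _≡ᵇ_; _≟_)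
open import Data.Nat.Properties
open import Data.Nat.Tactic.RingSolver using (solve-∀)
open import Data.Product using (Σ; _×_; _,_; proj₁; proj₂; uncurry)
open import Data.Sum using (inj₁; inj₂; _⊎_; [_,_]′)
open import Data.Vec using (Vec; []; _∷_)
open import Relation.Nullary using (¬_; yes; no)
open import Relation.Unary using (Decidable)
open import Relation.Binary.PropositionalEquality
open import Function using (_∘_; Equivalence)

MinimalWitness : (ℕ → Set) → Set
MinimalWitness P = Σ ℕ λ y → P y × (∀ z → z < y → ¬ P z)

module _ {P : ℕ → Set} (P? : Decidable P) where

  minimalWitness-below : ∀ w → MinimalWitness P ⊎ (∀ z → z < w → ¬ P z)
  minimalWitness-below zero = inj₂ λ _ ()
  minimalWitness-below (suc w) with minimalWitness-below w
  ... | inj₁ r = inj₁ r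
  ... | inj₂ none with P? w
  ...   | yes pw = inj₁ (w , pw , none)
  ...   | no ¬pw = inj₂ λ z z<1+w → [ none z , (λ { refl → ¬pw }) ]′ (m<1+n⇒m<n∨m≡n z<1+w)

  minimalWitness : ∀ w → P w → MinimalWitness P
  minimalWitness w pw with minimalWitness-below w
  ... | inj₁ r = r
  ... | inj₂ none = w , pw , none

module _ {A : SetNat} where

  eval-comp₁ : ∀ {n} {f : PR 1} {g : PR n} {xs y z} →
               Eval A g xs y → Eval A f (y ∷ []) z → Eval A (comp f (g ∷ [])) xs z
  eval-comp₁ eg ef = ev-comp (evv-∷ eg evv-[]) ef

  eval-comp₂ : ∀ {n} {f : PR 2} {g h : PR n} {xs y₁ y₂ z} →
               Eval A g xs y₁ → Eval A h xs y₂ → Eval A f (y₁ ∷ y₂ ∷ []) z →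
               Eval A (comp f (g ∷ h ∷ [])) xs z
  eval-comp₂ eg eh ef = ev-comp (evv-∷ eg (evv-∷ eh evv-[])) ef

  eval-prec : ∀ {n} {g : PR n} {h : PR (suc (suc n))} (F : ℕ → Vec ℕ n → ℕ) →
              (∀ xs → Eval A g xs (F 0 xs)) →
              (∀ k xs → Eval A h (k ∷ F k xs ∷ xs) (F (suc k) xs)) →
              ∀ k xs → Eval A (prec g h) (k ∷ xs) (F k xs)
  eval-prec F eg eh zero    xs = ev-prec0 (eg xs)
  eval-prec F eg eh (suc k) xs = ev-precS (eval-prec F eg eh k xs) (eh k xs)

  eval-mu : ∀ {n} {f : PR (suc n)} {xs : Vec ℕ n} (v : ℕ → ℕ) →
            (∀ y → Eval A f (y ∷ xs) (v y)) →
            (r : MinimalWitness (λ y → v y ≡ 0)) → Eval A (mu f) xs (proj₁ r)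
  eval-mu v ef (y , vy≡0 , below) = ev-mu (subst (Eval A _ _) vy≡0 (ef y)) nonzero-below
    where
    nonzero-below : ∀ z → z < y → Σ ℕ λ k → Eval A _ (z ∷ _) (suc k)
    nonzero-below z z<y with v z in vz | ef z
    ... | zero  | _  = ⊥-elim (below z z<y vz)
    ... | suc k | ez = k , ez

isOdd : ℕ → Bool
isOdd zero    = false
isOdd (suc n) = not (isOdd n)

shift : ℕ → ℕ → ℕ
shift zero    m = m
shift (suc n) m = ⌊ shift n m /2⌋

oneᴾ : PR 0
oneᴾ = comp succ (zer ∷ [])

isZeroᴾ : PR 1
isZeroᴾ = prec oneᴾ zer

predᴾ : PR 1
predᴾ = prec zer (proj (# 0))

addᴾ : PR 2
addᴾ = prec (proj (# 0)) (comp succ (proj (# 1) ∷ []))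

mulᴾ : PR 2
mulᴾ = prec zer (comp addᴾ (proj (# 2) ∷ proj (# 1) ∷ []))

monusᴾ : PR 2
monusᴾ = prec (proj (# 0)) (comp predᴾ (proj (# 1) ∷ []))

pow2ᴾ : PR 1
pow2ᴾ = prec oneᴾ (comp addᴾ (proj (# 1) ∷ proj (# 1) ∷ []))

isOddᴾ : PR 1
isOddᴾ = prec zer (comp isZeroᴾ (proj (# 1) ∷ []))

halfᴾ : PR 1
halfᴾ = prec zer (comp addᴾ (proj (# 1) ∷ comp isOddᴾ (proj (# 0) ∷ []) ∷ []))

shiftᴾ : PR 2
shiftᴾ = prec (proj (# 0)) (comp halfᴾ (proj (# 1) ∷ []))

eqᴾ : PR 2
eqᴾ = comp isZeroᴾ (comp addᴾ (comp monusᴾ (proj (# 0) ∷ proj (# 1) ∷ [])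
                             ∷ comp monusᴾ (proj (# 1) ∷ proj (# 0) ∷ []) ∷ []) ∷ [])

b2n≡ᵇ0 : ∀ b → (b2n b ≡ᵇ 0) ≡ not b
b2n≡ᵇ0 true  = refl
b2n≡ᵇ0 false = refl

⌊1+n/2⌋≡⌊n/2⌋+odd : ∀ n → ⌊ suc n /2⌋ ≡ ⌊ n /2⌋ + b2n (isOdd n)
⌊1+n/2⌋≡⌊n/2⌋+odd zero          = refl
⌊1+n/2⌋≡⌊n/2⌋+odd (suc zero)    = refl
⌊1+n/2⌋≡⌊n/2⌋+odd (suc (suc n)) rewrite not-involutive (isOdd n) =
  cong suc (⌊1+n/2⌋≡⌊n/2⌋+odd n)

∸+∸≡ᵇ0 : ∀ m n → ((n ∸ m) + (m ∸ n) ≡ᵇ 0) ≡ (m ≡ᵇ n)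
∸+∸≡ᵇ0 zero    zero    = refl
∸+∸≡ᵇ0 zero    (suc n) = refl
∸+∸≡ᵇ0 (suc m) zero    = refl
∸+∸≡ᵇ0 (suc m) (suc n) = ∸+∸≡ᵇ0 m n

module _ {A : SetNat} where

  eval-one : Eval A oneᴾ [] 1
  eval-one = eval-comp₁ ev-zer ev-succ

  eval-isZero : ∀ n → Eval A isZeroᴾ (n ∷ []) (b2n (n ≡ᵇ 0))
  eval-isZero n = eval-prec (λ k _ → b2n (k ≡ᵇ 0)) (λ { [] → eval-one }) (λ _ _ → ev-zer) n []

  eval-pred : ∀ n → Eval A predᴾ (n ∷ []) (pred n)
  eval-pred n = eval-prec (λ k _ → pred k) (λ { [] → ev-zer }) (λ _ _ → ev-proj (# 0)) n []

  eval-add : ∀ m n → Eval A addᴾ (m ∷ n ∷ []) (m + n)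
  eval-add m n = eval-prec (λ { k (n ∷ []) → k + n }) (λ { (n ∷ []) → ev-proj (# 0) })
    (λ { k (n ∷ []) → eval-comp₁ (ev-proj (# 1)) ev-succ }) m (n ∷ [])

  eval-mul : ∀ m n → Eval A mulᴾ (m ∷ n ∷ []) (m * n)
  eval-mul m n = eval-prec (λ { k (n ∷ []) → k * n }) (λ { (n ∷ []) → ev-zer })
    (λ { k (n ∷ []) → eval-comp₂ (ev-proj (# 2)) (ev-proj (# 1)) (eval-add n (k * n)) })
    m (n ∷ [])

  -- Primitive recursion runs on the first argument, so monusᴾ takes the subtrahend first.
  eval-monus : ∀ n m → Eval A monusᴾ (n ∷ m ∷ []) (m ∸ n)
  eval-monus n m = eval-prec (λ { k (m ∷ []) → m ∸ k }) (λ { (m ∷ []) → ev-proj (# 0) })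
    (λ { k (m ∷ []) → subst (Eval A _ _) (pred[m∸n]≡m∸[1+n] m k)
                             (eval-comp₁ (ev-proj (# 1)) (eval-pred (m ∸ k))) })
    n (m ∷ [])

  eval-pow2 : ∀ n → Eval A pow2ᴾ (n ∷ []) (2 ^ n)
  eval-pow2 n = eval-prec (λ k _ → 2 ^ k) (λ { [] → eval-one })
    (λ k _ → subst (Eval A _ _) (cong (2 ^ k +_) (sym (+-identityʳ (2 ^ k))))
                   (eval-comp₂ (ev-proj (# 1)) (ev-proj (# 1)) (eval-add (2 ^ k) (2 ^ k))))
    n []

  eval-isOdd : ∀ n → Eval A isOddᴾ (n ∷ []) (b2n (isOdd n))
  eval-isOdd n = eval-prec (λ k _ → b2n (isOdd k)) (λ { [] → ev-zer })
    (λ k _ → subst (Eval A _ _) (cong b2n (b2n≡ᵇ0 (isOdd k)))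
                   (eval-comp₁ (ev-proj (# 1)) (eval-isZero (b2n (isOdd k)))))
    n []

  eval-half : ∀ n → Eval A halfᴾ (n ∷ []) ⌊ n /2⌋
  eval-half n = eval-prec (λ k _ → ⌊ k /2⌋) (λ { [] → ev-zer })
    (λ k _ → subst (Eval A _ _) (sym (⌊1+n/2⌋≡⌊n/2⌋+odd k))
                   (eval-comp₂ (ev-proj (# 1)) (eval-comp₁ (ev-proj (# 0)) (eval-isOdd k))
                               (eval-add ⌊ k /2⌋ (b2n (isOdd k)))))
    n []

  eval-shift : ∀ n m → Eval A shiftᴾ (n ∷ m ∷ []) (shift n m)
  eval-shift n m = eval-prec (λ { k (m ∷ []) → shift k m }) (λ { (m ∷ []) → ev-proj (# 0) })
    (λ { k (m ∷ []) → eval-comp₁ (ev-proj (# 1)) (eval-half (shift k m)) }) n (m ∷ [])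

  eval-eq : ∀ m n → Eval A eqᴾ (m ∷ n ∷ []) (b2n (m ≡ᵇ n))
  eval-eq m n = subst (Eval A _ _) (cong b2n (∸+∸≡ᵇ0 m n))
    (eval-comp₁ (eval-comp₂ (eval-comp₂ (ev-proj (# 0)) (ev-proj (# 1)) (eval-monus m n))
                            (eval-comp₂ (ev-proj (# 1)) (ev-proj (# 0)) (eval-monus n m))
                            (eval-add (n ∸ m) (m ∸ n)))
                (eval-isZero _))

tail : SetNat → SetNat
tail X i = X (suc i)

-- code X k = 2 ^ k + Σ_{i<k} 2 ^ i · X i, the numeral with binary digits X 0, …, X (k - 1)
-- under a leading 1; the recursion is the one computed by codeᴾ below.
code : SetNat → ℕ → ℕ
code X zero    = 1
code X (suc k) = code X k + 2 ^ k * suc (b2n (X k))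

code-suc : ∀ X k → code X (suc k) ≡ b2n (X 0) + (code (tail X) k + code (tail X) k)
code-suc X zero = leading-one (b2n (X 0))
  where
  leading-one : ∀ b → 1 + 1 * suc b ≡ b + 2
  leading-one = solve-∀
code-suc X (suc k) = begin
  code X (suc k) + 2 ^ suc k * s                    ≡⟨ cong (_+ 2 ^ suc k * s) (code-suc X k) ⟩
  b2n (X 0) + (c + c) + 2 * 2 ^ k * s               ≡⟨ regroup (b2n (X 0)) c (2 ^ k) s ⟩
  b2n (X 0) + ((c + 2 ^ k * s) + (c + 2 ^ k * s))   ∎
  where
  open ≡-Reasoning
  c = code (tail X) k
  s = suc (b2n (X (suc k)))
  regroup : ∀ b c p s → b + (c + c) + 2 * p * s ≡ b + ((c + p * s) + (c + p * s))
  regroup = solve-∀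

code-step : ∀ X k → code X k < code X (suc k)
code-step X k = m<m+n (code X k) (≤-trans (m^n>0 2 k) (m≤m*n (2 ^ k) (suc (b2n (X k)))))

code-mono-< : ∀ X {m n} → m < n → code X m < code X n
code-mono-< X {m} {suc n} m<1+n with m<1+n⇒m<n∨m≡n m<1+n
... | inj₁ m<n  = <-trans (code-mono-< X m<n) (code-step X n)
... | inj₂ refl = code-step X n

code-cancel-≤ : ∀ X {m n} → code X m ≤ code X n → m ≤ n
code-cancel-≤ X le = ≮⇒≥ λ n<m → <⇒≱ (code-mono-< X n<m) le

n<code : ∀ X n → n < code X n
n<code X zero    = s≤s z≤n
n<code X (suc n) = ≤-trans (s≤s (n<code X n)) (code-step X n)

shift-suc : ∀ n m → shift (suc n) m ≡ shift n ⌊ m /2⌋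
shift-suc zero    m = refl
shift-suc (suc n) m = cong ⌊_/2⌋ (shift-suc n m)

shift-0 : ∀ n → shift n 0 ≡ 0
shift-0 zero    = refl
shift-0 (suc n) = cong ⌊_/2⌋ (shift-0 n)

⌊bit+double/2⌋ : ∀ b c → ⌊ b2n b + (c + c) /2⌋ ≡ c
⌊bit+double/2⌋ false c = sym (n≡⌊n+n/2⌋ c)
⌊bit+double/2⌋ true  c = sym (n≡⌈n+n/2⌉ c)

isOdd-double : ∀ c → isOdd (c + c) ≡ false
isOdd-double zero    = refl
isOdd-double (suc c) = begin
  not (isOdd (c + suc c))   ≡⟨ cong (not ∘ isOdd) (+-suc c c) ⟩
  not (not (isOdd (c + c))) ≡⟨ not-involutive _ ⟩
  isOdd (c + c)             ≡⟨ isOdd-double c ⟩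
  false                     ∎
  where open ≡-Reasoning

isOdd-bit+double : ∀ b c → isOdd (b2n b + (c + c)) ≡ b
isOdd-bit+double false c = isOdd-double c
isOdd-bit+double true  c = cong not (isOdd-double c)

shift-code-suc : ∀ X n k → shift (suc n) (code X (suc k)) ≡ shift n (code (tail X) k)
shift-code-suc X n k = trans (shift-suc n _)
  (cong (shift n) (trans (cong ⌊_/2⌋ (code-suc X k)) (⌊bit+double/2⌋ (X 0) (code (tail X) k))))

shift-code>0 : ∀ X n k → n ≤ k → 0 < shift n (code X k)
shift-code>0 X zero    k       _         = ≤-<-trans z≤n (n<code X k)
shift-code>0 X (suc n) (suc k) (s≤s n≤k) =
  subst (0 <_) (sym (shift-code-suc X n k)) (shift-code>0 (tail X) n k n≤k)

shift-code≡0 : ∀ X n k → k ≤ n → shift (suc n) (code X k) ≡ 0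
shift-code≡0 X n       zero    _         = trans (shift-suc n 1) (shift-0 n)
shift-code≡0 X (suc n) (suc k) (s≤s k≤n) =
  trans (shift-code-suc X (suc n) k) (shift-code≡0 (tail X) n k k≤n)

shift-code>0⇒< : ∀ X n k → 0 < shift (suc n) (code X k) → n < k
shift-code>0⇒< X n k pos = ≰⇒> λ k≤n → <-irrefl (sym (shift-code≡0 X n k k≤n)) pos

isOdd-shift-code : ∀ X n k → n < k → isOdd (shift n (code X k)) ≡ X n
isOdd-shift-code X zero    (suc k) _         =
  trans (cong isOdd (code-suc X k)) (isOdd-bit+double (X 0) (code (tail X) k))
isOdd-shift-code X (suc n) (suc k) (s≤s n<k) =
  trans (cong isOdd (shift-code-suc X n k)) (isOdd-shift-code (tail X) n k n<k)

codeᴾ : PR 1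
codeᴾ = prec oneᴾ (comp addᴾ (proj (# 1)
                             ∷ comp mulᴾ (comp pow2ᴾ (proj (# 0) ∷ [])
                                          ∷ comp succ (comp orc (proj (# 0) ∷ []) ∷ []) ∷ [])
                             ∷ []))

eval-code : ∀ {X} k → Eval X codeᴾ (k ∷ []) (code X k)
eval-code {X} k = eval-prec (λ j _ → code X j) (λ { [] → eval-one }) step k []
  where
  step : ∀ j xs → Eval X _ (j ∷ code X j ∷ xs) (code X (suc j))
  step j _ = eval-comp₂ (ev-proj (# 1))
    (eval-comp₂ (eval-comp₁ (ev-proj (# 0)) (eval-pow2 j))
                (eval-comp₁ (eval-comp₁ (ev-proj (# 0)) ev-orc) ev-succ)
                (eval-mul (2 ^ j) (suc (b2n (X j)))))
    (eval-add (code X j) (2 ^ j * suc (b2n (X j))))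

-- m ∸ code X k ≡ 0 is m ≤ code X k in the form a machine can test.
codeIndexWitness : (X : SetNat) (m : ℕ) → MinimalWitness (λ k → m ∸ code X k ≡ 0)
codeIndexWitness X m =
  minimalWitness (λ k → m ∸ code X k ≟ 0) m (m≤n⇒m∸n≡0 (<⇒≤ (n<code X m)))

codeIndex : SetNat → ℕ → ℕ
codeIndex X m = proj₁ (codeIndexWitness X m)

Prefixes : SetNat → SetNat
Prefixes X m = code X (codeIndex X m) ≡ᵇ m

codeIndexᴾ : PR 1
codeIndexᴾ = mu (comp monusᴾ (comp codeᴾ (proj (# 0) ∷ []) ∷ proj (# 1) ∷ []))

Prefixesᴾ : PR 1
Prefixesᴾ = comp eqᴾ (comp codeᴾ (codeIndexᴾ ∷ []) ∷ proj (# 0) ∷ [])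

Prefixes-≤T : ∀ X → Prefixes X ≤T X
Prefixes-≤T X = Prefixesᴾ , λ m →
  eval-comp₂ (eval-comp₁ (eval-codeIndex m) (eval-code (codeIndex X m))) (ev-proj (# 0))
             (eval-eq (code X (codeIndex X m)) m)
  where
  eval-codeIndex : ∀ m → Eval X codeIndexᴾ (m ∷ []) (codeIndex X m)
  eval-codeIndex m = eval-mu (λ k → m ∸ code X k)
    (λ k → eval-comp₂ (eval-comp₁ (ev-proj (# 0)) (eval-code k)) (ev-proj (# 1))
                      (eval-monus (code X k) m))
    (codeIndexWitness X m)

codeIndex-code : ∀ X n → codeIndex X (code X n) ≡ n
codeIndex-code X n = least-is-n (codeIndexWitness X (code X n))
  where
  least-is-n : (r : MinimalWitness (λ k → code X n ∸ code X k ≡ 0)) → proj₁ r ≡ n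
  least-is-n (k , n≤k , below) =
    ≤-antisym (≮⇒≥ λ n<k → below n n<k (n∸n≡0 (code X n))) (code-cancel-≤ X (m∸n≡0⇒m≤n n≤k))

Prefixes-code : ∀ X n → Prefixes X (code X n) ≡ true
Prefixes-code X n = Equivalence.to T-≡
  (subst (λ k → T (code X k ≡ᵇ code X n)) (sym (codeIndex-code X n)) (≡⇒≡ᵇ (code X n) (code X n) refl))

Prefixes⇒code : ∀ X {m} → Prefixes X m ≡ true → code X (codeIndex X m) ≡ m
Prefixes⇒code X eq = ≡ᵇ⇒≡ _ _ (Equivalence.from T-≡ eq)

Prefixes-infinite : ∀ X → Infinite (Prefixes X)
Prefixes-infinite X n = code X n , <⇒≤ (n<code X n) , Prefixes-code X n

failedTests : Bool → ℕ → ℕ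
failedTests b s = b2n (b2n b ≡ᵇ 0) + b2n (s ≡ᵇ 0)

failedTests≡0⇒ : ∀ b s → failedTests b s ≡ 0 → b ≡ true × 0 < s
failedTests≡0⇒ true (suc s) _ = refl , s≤s z≤n

⇒failedTests≡0 : ∀ {b s} → b ≡ true → 0 < s → failedTests b s ≡ 0
⇒failedTests≡0 refl (s≤s _) = refl

-- On input n, searchᴾ finds the least M with Y M and M ≥ 2 ^ (n + 1).
searchᴾ : PR 1
searchᴾ = mu (comp addᴾ
  (comp isZeroᴾ (comp orc (proj (# 0) ∷ []) ∷ [])
  ∷ comp isZeroᴾ (comp shiftᴾ (comp succ (proj (# 1) ∷ []) ∷ proj (# 0) ∷ []) ∷ [])
  ∷ []))

decodeᴾ : PR 1
decodeᴾ = comp isOddᴾ (comp shiftᴾ (proj (# 0) ∷ searchᴾ ∷ []) ∷ [])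

infinite⊆Prefixes⇒≤T : ∀ X Y → Y ⊆ˢ Prefixes X → Infinite Y → X ≤T Y
infinite⊆Prefixes⇒≤T X Y Y⊆ Y-inf = decodeᴾ , eval-decode
  where
  Y-code : ∀ {M} → Y M ≡ true → Σ ℕ λ k → code X k ≡ M
  Y-code {M} yM = codeIndex X M , Prefixes⇒code X (Y⊆ M yM)

  failures : ℕ → ℕ → ℕ
  failures n M = failedTests (Y M) (shift (suc n) M)

  long-element : ∀ n → Σ ℕ λ M → failures n M ≡ 0
  long-element n with Y-inf (code X (suc n))
  ... | M , code≤M , yM with Y-code yM
  ...   | k , refl = code X k , ⇒failedTests≡0 yM
                       (shift-code>0 X (suc n) k (code-cancel-≤ X {suc n} {k} code≤M))

  search : ∀ n → MinimalWitness (λ M → failures n M ≡ 0)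
  search n = uncurry (minimalWitness (λ M → failures n M ≟ 0)) (long-element n)

  decode : ∀ n M → failures n M ≡ 0 → isOdd (shift n M) ≡ X n
  decode n M fails≡0 with failedTests≡0⇒ (Y M) (shift (suc n) M) fails≡0
  ... | yM , long with Y-code yM
  ...   | k , refl = isOdd-shift-code X n k (shift-code>0⇒< X n k long)

  eval-decode : ∀ n → Eval Y decodeᴾ (n ∷ []) (b2n (X n))
  eval-decode n = subst (Eval Y decodeᴾ (n ∷ [])) (cong b2n (decode n M (proj₁ (proj₂ (search n)))))
    (eval-comp₁ (eval-comp₂ (ev-proj (# 0)) eval-search (eval-shift n M)) (eval-isOdd (shift n M)))
    where
    M = proj₁ (search n)
    eval-search : Eval Y searchᴾ (n ∷ []) M
    eval-search = eval-mu (failures n)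
      (λ M → eval-comp₂
        (eval-comp₁ (eval-comp₁ (ev-proj (# 0)) ev-orc) (eval-isZero (b2n (Y M))))
        (eval-comp₁ (eval-comp₂ (eval-comp₁ (ev-proj (# 1)) ev-succ) (ev-proj (# 0))
                                (eval-shift (suc n) M))
                    (eval-isZero (shift (suc n) M)))
        (eval-add (b2n (b2n (Y M) ≡ᵇ 0)) (b2n (shift (suc n) M ≡ᵇ 0))))
      (search n)

proposition5p2 : ∀ {ℓ} (𝓘 𝓙 : Collection ℓ) →
    IsTuringIdeal 𝓘 → IsTuringIdeal 𝓙 → 𝓘 ⊆ᶜ 𝓙 →
    (∀ X → 𝓙 X → Infinite X → Σ SetNat (λ Y → Y ⊆ˢ X × Infinite Y × 𝓘 Y)) →
    (𝓘 ⊆ᶜ 𝓙) × (𝓙 ⊆ᶜ 𝓘)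
proposition5p2 𝓘 𝓙 𝓘-ideal 𝓙-ideal 𝓘⊆𝓙 infinite-subset = 𝓘⊆𝓙 , 𝓙⊆𝓘
  where
  open IsTuringIdeal

  𝓙⊆𝓘 : 𝓙 ⊆ᶜ 𝓘
  𝓙⊆𝓘 X X∈𝓙 with infinite-subset (Prefixes X)
                   (closed-≤T 𝓙-ideal X (Prefixes X) X∈𝓙 (Prefixes-≤T X)) (Prefixes-infinite X)
  ... | Y , Y⊆ , Y-inf , Y∈𝓘 = closed-≤T 𝓘-ideal Y X Y∈𝓘 (infinite⊆Prefixes⇒≤T X Y Y⊆ Y-inf)
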